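{- Let $p\ge 7$ be a prime. Let $A_0$ be the set of nonzero quadratic residues modulo $p$ and $A_1$ the set of quadratic non-residues modulo $p$ (both subsets of $\{1,\ldots,p-1\}$). For $i,j\in\{0,1\}$ let $A_{ij}=\{a\in\{1,\ldots,p-1\}: a\in A_i,\ a+1\in A_j\}$ (with $a+1$ taken modulo $p$). Then, modulo $p$ (with $\frac{1}{32}$ denoting the inverse of $32$ modulo $p$), $$\sum_{a\in A_{00}}(a^2+a)\equiv\sum_{a\in A_{11}}(a^2+a)\equiv\frac{1}{32},\qquad \sum_{a\in A_{01}}(a^2+a)\equiv\sum_{a\in A_{10}}(a^2+a)\equiv-\frac{1}{32}.$$ -}

module Defs where

open import Data.Nat using (ℕ; zero; suc; _+_; _*_; _%_; NonZero)
open import Data.Nat.Properties using (_≟_)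
open import Data.Fin using (Fin; toℕ)
open import Data.Fin.Properties using (any?)
open import Data.List using (List; map; filter; upTo)
open import Data.Nat.ListAction using (sum)
open import Data.Product using (∃; _×_)
open import Data.Bool using (Bool; true; false)
open import Relation.Nullary using (Dec; yes; no; ¬_)
open import Relation.Nullary.Decidable using (_×-dec_; ¬?)
open import Relation.Binary.PropositionalEquality using (_≡_)

IsQR : (p : ℕ) .{{_ : NonZero p}} → ℕ → Set
IsQR p a = ¬ (a % p ≡ 0) × ∃ λ (x : Fin p) → (toℕ x * toℕ x) % p ≡ a % p

IsQNR : (p : ℕ) .{{_ : NonZero p}} → ℕ → Set
IsQNR p a = ¬ (a % p ≡ 0) × ¬ (∃ λ (x : Fin p) → (toℕ x * toℕ x) % p ≡ a % p)

isSq? : (p : ℕ) .{{_ : NonZero p}} → (a : ℕ) → Dec (∃ λ (x : Fin p) → (toℕ x * toℕ x) % p ≡ a % p)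
isSq? p a = any? (λ x → ((toℕ x * toℕ x) % p) ≟ (a % p))

IsQR? : (p : ℕ) .{{_ : NonZero p}} → (a : ℕ) → Dec (IsQR p a)
IsQR? p a = ¬? ((a % p) ≟ 0) ×-dec isSq? p a

IsQNR? : (p : ℕ) .{{_ : NonZero p}} → (a : ℕ) → Dec (IsQNR p a)
IsQNR? p a = ¬? ((a % p) ≟ 0) ×-dec ¬? (isSq? p a)

InA : (p : ℕ) .{{_ : NonZero p}} → Bool → ℕ → Set
InA p false a = IsQR p a
InA p true  a = IsQNR p a

InA? : (p : ℕ) .{{_ : NonZero p}} → (i : Bool) → (a : ℕ) → Dec (InA p i a)
InA? p false a = IsQR? p a
InA? p true  a = IsQNR? p a

range1 : ℕ → List ℕ
range1 zero = Data.List.[]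
range1 (suc n) = map suc (upTo n)

-- A_ij = {a ∈ {1,…,p-1} : a ∈ A_i, a+1 ∈ A_j}  (a+1 taken mod p via the % in IsQR/IsQNR)
Aij : (p : ℕ) .{{_ : NonZero p}} → Bool → Bool → List ℕ
Aij p i j = filter (λ a → InA? p i a ×-dec InA? p j (a + 1)) (range1 p)

S : (p : ℕ) .{{_ : NonZero p}} → Bool → Bool → ℕ
S p i j = sum (map (λ a → a * a + a) (Aij p i j))

module Submission where

-- Work in ℤ/pℤ, write f(a) = a² + a, χ for the indicator of the nonzero squares and T i j
-- for the sum of f over A_ij.  Summing T i j over one index removes one character factor and
-- leaves ∑ χ(a) f(a), ∑ χ(a+1) f(a) or ∑ (1 - χ(a)) f(a).  All three vanish: counting square
-- roots gives 2 ∑ χ(b) g(b) = ∑ g(x²) whenever g(0) = 0, and the power sums ∑ x, ∑ x², ∑ x⁴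
-- vanish for p ≥ 7 (substitute x ↦ 2x).  So everything is fixed by T₀₀, and 4 T₀₀ = ∑ x²y²
-- over the points of the conic y² = x² + 1.  The conic is parametrised by u = y - x ≠ 0, with
-- x = (u⁻¹ - u)/2, and then 16 x²y² = u⁻⁴ - 2 + u⁴; summing over u gives 64 T₀₀ = -2(p - 1) = 2.

open import Algebra.Bundles using (Semiring; CommutativeRing)
open import Algebra.Structures using (IsCommutativeRing)
open import Data.Bool.Base using (Bool; true; false; if_then_else_)
open import Data.Fin.Base using (Fin; zero; suc; toℕ; fromℕ<)
open import Data.Fin.Permutation using (Permutation; permutation)
open import Data.Fin.Properties using (_≟_; toℕ-fromℕ<; toℕ<n; toℕ-injective)
open import Data.Nat.Base as ℕ using (ℕ; NonZero; _%_; _∸_)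
open import Data.Nat.Coprimality using (prime⇒coprime; coprime-Bézout)
import Data.Nat.Divisibility as ℕ
open import Data.Nat.Divisibility using (n∣m⇒m%n≡0; m%n≡0⇒n∣m)
open import Data.Nat.DivMod using (m<n⇒m%n≡m; m%n%n≡m%n)
open import Data.Nat.GCD using (module Bézout)
open import Data.Nat.Primality using (Prime; euclidsLemma; prime⇒nonTrivial)
import Data.Nat.Properties as ℕ
open import Data.Product using (_×_; _,_; ∃; proj₁)
open import Data.Sum using (_⊎_; inj₁; inj₂; [_,_]′)
open import Function using (_∘_; id; _⇔_; mk⇔; Equivalence)
open import Level using (0ℓ)
open import Relation.Binary.Bundles using (Setoid)
open import Relation.Binary.PropositionalEquality as ≡ using (_≡_; _≢_; cong; cong₂)
import Relation.Binary.Reasoning.Setoid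
open import Relation.Binary.Structures using (IsEquivalence)
open import Relation.Nullary using (¬_; Dec; does; yes; no; contradiction)
open import Relation.Nullary.Decidable using (_×-dec_)
open import Relation.Unary using (Decidable)

open import Defs using (IsQR; IsQR?; IsQNR?; InA; InA?; S)

module KroneckerSums {c ℓ} (R : Semiring c ℓ) where

  open Semiring R hiding (zero)
  open import Algebra.Properties.Semiring.Sum R
  open import Relation.Binary.Reasoning.Setoid setoid

  𝟙 : ∀ {a} {A : Set a} → Dec A → Carrier
  𝟙 a? = if does a? then 1# else 0#

  𝟙-yes : ∀ {a} {A : Set a} (a? : Dec A) → A → 𝟙 a? ≡ 1#
  𝟙-yes (yes _) _ = ≡.refl
  𝟙-yes (no ¬a) a = contradiction a ¬a

  𝟙-no : ∀ {a} {A : Set a} (a? : Dec A) → ¬ A → 𝟙 a? ≡ 0#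
  𝟙-no (yes a) ¬a = contradiction a ¬a
  𝟙-no (no _)  _  = ≡.refl

  𝟙-cong : ∀ {a b} {A : Set a} {B : Set b} (a? : Dec A) (b? : Dec B) → A ⇔ B → 𝟙 a? ≡ 𝟙 b?
  𝟙-cong a? (yes b) A⇔B = 𝟙-yes a? (Equivalence.from A⇔B b)
  𝟙-cong a? (no ¬b) A⇔B = 𝟙-no a? (¬b ∘ Equivalence.to A⇔B)

  𝟙-×-dec : ∀ {a b} {A : Set a} {B : Set b} (a? : Dec A) (b? : Dec B) →
            𝟙 (a? ×-dec b?) ≈ 𝟙 a? * 𝟙 b?
  𝟙-×-dec (yes _) (yes _) = sym (*-identityˡ 1#)
  𝟙-×-dec (yes _) (no _)  = sym (*-identityˡ 0#)
  𝟙-×-dec (no _)  b?      = sym (zeroˡ (𝟙 b?))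

  𝟙-complement : ∀ {a b} {A : Set a} {B : Set b} (a? : Dec A) (b? : Dec B) →
                 (A → ¬ B) → (¬ A → B) → 𝟙 a? + 𝟙 b? ≈ 1#
  𝟙-complement (yes a) b? A→¬B _ = trans (+-congˡ (reflexive (𝟙-no b? (A→¬B a)))) (+-identityʳ 1#)
  𝟙-complement (no ¬a) b? _ ¬A→B = trans (+-congˡ (reflexive (𝟙-yes b? (¬A→B ¬a)))) (+-identityˡ 1#)

  𝟙-⊎ : ∀ {a b c} {A : Set a} {B : Set b} {C : Set c} (a? : Dec A) (b? : Dec B) (c? : Dec C) →
        (A → ¬ B) → C ⇔ (A ⊎ B) → 𝟙 c? ≈ 𝟙 a? + 𝟙 b?
  𝟙-⊎ (yes a) (yes b) c? A→¬B _ = contradiction b (A→¬B a)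
  𝟙-⊎ (yes a) (no _)  c? _ C⇔A⊎B =
    trans (reflexive (𝟙-yes c? (Equivalence.from C⇔A⊎B (inj₁ a)))) (sym (+-identityʳ 1#))
  𝟙-⊎ (no _)  (yes b) c? _ C⇔A⊎B =
    trans (reflexive (𝟙-yes c? (Equivalence.from C⇔A⊎B (inj₂ b)))) (sym (+-identityˡ 1#))
  𝟙-⊎ (no ¬a) (no ¬b) c? _ C⇔A⊎B =
    trans (reflexive (𝟙-no c? ([ ¬a , ¬b ]′ ∘ Equivalence.to C⇔A⊎B))) (sym (+-identityˡ 0#))

  δ : ∀ {n} → Fin n → Fin n → Carrier
  δ i j = 𝟙 (i ≟ j)

  δ-≢ : ∀ {n} {i j : Fin n} → i ≢ j → δ i j ≡ 0#
  δ-≢ {i = i} {j} = 𝟙-no (i ≟ j)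

  δ-sym : ∀ {n} (i j : Fin n) → δ i j ≡ δ j i
  δ-sym i j = 𝟙-cong (i ≟ j) (j ≟ i) (mk⇔ ≡.sym ≡.sym)

  ∑-δ : ∀ {n} (i : Fin n) (g : Fin n → Carrier) → ∑[ j < n ] (δ i j * g j) ≈ g i
  ∑-δ {ℕ.suc n} zero g = begin
    1# * g zero + ∑[ j < n ] (0# * g (suc j))
      ≈⟨ +-cong (*-identityˡ (g zero)) (sym (*-distribˡ-sum 0# (g ∘ suc))) ⟩
    g zero + 0# * ∑[ j < n ] g (suc j)
      ≈⟨ +-congˡ (zeroˡ (∑[ j < n ] g (suc j))) ⟩
    g zero + 0#
      ≈⟨ +-identityʳ (g zero) ⟩
    g zero
      ∎
  ∑-δ {ℕ.suc n} (suc i) g = begin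
    0# * g zero + ∑[ j < n ] (δ i j * g (suc j))  ≈⟨ +-cong (zeroˡ (g zero)) (∑-δ i (g ∘ suc)) ⟩
    0# + g (suc i)                               ≈⟨ +-identityˡ (g (suc i)) ⟩
    g (suc i)                                    ∎

  ∑-δ≈1 : ∀ {n} (j : Fin n) → ∑[ i < n ] δ i j ≈ 1#
  ∑-δ≈1 {n} j = begin
    ∑[ i < n ] δ i j         ≡⟨ sum-cong-≗ (λ i → δ-sym i j) ⟩
    ∑[ i < n ] δ j i         ≈⟨ sum-cong-≋ (λ i → sym (*-identityʳ (δ j i))) ⟩
    ∑[ i < n ] (δ j i * 1#)  ≈⟨ ∑-δ j (λ _ → 1#) ⟩
    1#                       ∎

  ∑-fibres : ∀ {m n} (φ : Fin m → Fin n) (g : Fin n → Carrier) →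
             ∑[ i < m ] g (φ i) ≈ ∑[ j < n ] ((∑[ i < m ] δ (φ i) j) * g j)
  ∑-fibres {m} {n} φ g = begin
    ∑[ i < m ] g (φ i)
      ≈⟨ sum-cong-≋ (λ i → sym (∑-δ (φ i) g)) ⟩
    ∑[ i < m ] ∑[ j < n ] (δ (φ i) j * g j)
      ≈⟨ ∑-comm (λ i j → δ (φ i) j * g j) ⟩
    ∑[ j < n ] ∑[ i < m ] (δ (φ i) j * g j)
      ≈⟨ sum-cong-≋ (λ j → sym (*-distribʳ-sum (g j) (λ i → δ (φ i) j))) ⟩
    ∑[ j < n ] ((∑[ i < m ] δ (φ i) j) * g j)
      ∎

module FilteredSums where

  open import Data.Integer.Base using (ℤ; +_; _+_; _*_)
  import Data.Integer.Properties as ℤ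
  open import Data.List.Base using (_∷_; map; filter; applyUpTo)
  open import Data.Nat.ListAction using () renaming (sum to listSum)
  open import Algebra.Properties.Semiring.Sum ℤ.+-*-semiring using (sum; sum-syntax)
  open KroneckerSums ℤ.+-*-semiring using (𝟙)

  map-applyUpTo : ∀ {a b} {A : Set a} {B : Set b} (g : A → B) (f : ℕ → A) n →
                  map g (applyUpTo f n) ≡ applyUpTo (g ∘ f) n
  map-applyUpTo g f ℕ.zero    = ≡.refl
  map-applyUpTo g f (ℕ.suc n) = cong (g (f 0) ∷_) (map-applyUpTo g (f ∘ ℕ.suc) n)

  sum-filter-applyUpTo : ∀ {p} {P : ℕ → Set p} (P? : Decidable P) (g f : ℕ → ℕ) n →
                         + listSum (map g (filter P? (applyUpTo f n)))
                           ≡ ∑[ i < n ] (𝟙 (P? (f (toℕ i))) * + g (f (toℕ i)))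
  sum-filter-applyUpTo P? g f ℕ.zero = ≡.refl
  sum-filter-applyUpTo P? g f (ℕ.suc n) with P? (f 0)
  ... | yes _ = ≡.trans (ℤ.pos-+ (g (f 0)) _)
                  (cong₂ _+_ (≡.sym (ℤ.*-identityˡ (+ g (f 0)))) (sum-filter-applyUpTo P? g (f ∘ ℕ.suc) n))
  ... | no _  = ≡.trans (sum-filter-applyUpTo P? g (f ∘ ℕ.suc) n) (≡.sym (ℤ.+-identityˡ _))

module IntegersModulo (n : ℕ) where

  open import Data.Integer.Base using (ℤ; +_; _+_; _*_; -_; _-_; 0ℤ; 1ℤ; ∣_∣; _^_; _%ℕ_; _/ℕ_)
  import Data.Integer.DivMod as ℤ
  open import Data.Integer.Divisibility.Signed
    using (_∣_; divides; ∣m∣n⇒∣m+n; ∣n⇒∣m*n; ∣m⇒∣-m; ∣⇒∣ᵤ; ∣ᵤ⇒∣)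
  import Data.Integer.Properties as ℤ
  open import Data.Integer.Tactic.RingSolver using (solve-∀)

  -- A record rather than a synonym for n ∣ x - y, so that x and y can be inferred.

  infix 4 _≈_
  record _≈_ (x y : ℤ) : Set where
    constructor ∣⇒≈
    field n∣x-y : + n ∣ x - y

  ≈-reflexive : ∀ {x y} → x ≡ y → x ≈ y
  ≈-reflexive {x} ≡.refl = ∣⇒≈ (divides 0ℤ (ℤ.+-inverseʳ x))

  ≈-refl : ∀ {x} → x ≈ x
  ≈-refl = ≈-reflexive ≡.refl

  ≈-sym : ∀ {x y} → x ≈ y → y ≈ x
  ≈-sym {x} {y} (∣⇒≈ n∣x-y) = ∣⇒≈ (≡.subst (+ n ∣_) (negate x y) (∣m⇒∣-m n∣x-y))
    where
    negate : ∀ x y → - (x - y) ≡ y - x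
    negate = solve-∀

  ≈-trans : ∀ {x y z} → x ≈ y → y ≈ z → x ≈ z
  ≈-trans {x} {y} {z} (∣⇒≈ n∣x-y) (∣⇒≈ n∣y-z) =
    ∣⇒≈ (≡.subst (+ n ∣_) (ℤ.+-minus-telescope x y z) (∣m∣n⇒∣m+n n∣x-y n∣y-z))

  ≈-isEquivalence : IsEquivalence _≈_
  ≈-isEquivalence = record { refl = ≈-refl ; sym = ≈-sym ; trans = ≈-trans }

  ≈-setoid : Setoid 0ℓ 0ℓ
  ≈-setoid = record { isEquivalence = ≈-isEquivalence }

  +-cong : ∀ {x x′ y y′} → x ≈ x′ → y ≈ y′ → x + y ≈ x′ + y′
  +-cong {x} {x′} {y} {y′} (∣⇒≈ n∣x-x′) (∣⇒≈ n∣y-y′) =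
    ∣⇒≈ (≡.subst (+ n ∣_) (regroup x x′ y y′) (∣m∣n⇒∣m+n n∣x-x′ n∣y-y′))
    where
    regroup : ∀ x x′ y y′ → (x - x′) + (y - y′) ≡ (x + y) - (x′ + y′)
    regroup = solve-∀

  *-cong : ∀ {x x′ y y′} → x ≈ x′ → y ≈ y′ → x * y ≈ x′ * y′
  *-cong {x} {x′} {y} {y′} (∣⇒≈ n∣x-x′) (∣⇒≈ n∣y-y′) =
    ∣⇒≈ (≡.subst (+ n ∣_) (telescope x x′ y y′) (∣m∣n⇒∣m+n (∣n⇒∣m*n y n∣x-x′) (∣n⇒∣m*n x′ n∣y-y′)))
    where
    telescope : ∀ x x′ y y′ → y * (x - x′) + x′ * (y - y′) ≡ x * y - x′ * y′
    telescope = solve-∀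

  -‿cong : ∀ {x x′} → x ≈ x′ → - x ≈ - x′
  -‿cong {x} {x′} (∣⇒≈ n∣x-x′) = ∣⇒≈ (≡.subst (+ n ∣_) (ℤ.neg-distrib-+ x (- x′)) (∣m⇒∣-m n∣x-x′))

  isCommutativeRing : IsCommutativeRing _≈_ _+_ _*_ -_ 0ℤ 1ℤ
  isCommutativeRing = record
    { isRing = record
      { +-isAbelianGroup = record
        { isGroup = record
          { isMonoid = record
            { isSemigroup = record
              { isMagma = record { isEquivalence = ≈-isEquivalence ; ∙-cong = +-cong }
              ; assoc   = λ x y z → ≈-reflexive (ℤ.+-assoc x y z)
              }
            ; identity = (λ x → ≈-reflexive (ℤ.+-identityˡ x)) , (λ x → ≈-reflexive (ℤ.+-identityʳ x))
            }
          ; inverse = (λ x → ≈-reflexive (ℤ.+-inverseˡ x)) , (λ x → ≈-reflexive (ℤ.+-inverseʳ x))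
          ; ⁻¹-cong = -‿cong
          }
        ; comm = λ x y → ≈-reflexive (ℤ.+-comm x y)
        }
      ; *-cong     = *-cong
      ; *-assoc    = λ x y z → ≈-reflexive (ℤ.*-assoc x y z)
      ; *-identity = (λ x → ≈-reflexive (ℤ.*-identityˡ x)) , (λ x → ≈-reflexive (ℤ.*-identityʳ x))
      ; distrib    = (λ x y z → ≈-reflexive (ℤ.*-distribˡ-+ x y z))
                   , (λ x y z → ≈-reflexive (ℤ.*-distribʳ-+ x y z))
      }
    ; *-comm = λ x y → ≈-reflexive (ℤ.*-comm x y)
    }

  ℤ/nℤ : CommutativeRing 0ℓ 0ℓ
  ℤ/nℤ = record { isCommutativeRing = isCommutativeRing }

  open CommutativeRing ℤ/nℤ public using (semiring)
  open import Algebra.Properties.Semiring.Sum semiring public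
  open KroneckerSums semiring public
  module ≈-Reasoning = Relation.Binary.Reasoning.Setoid ≈-setoid

  ≈0⇒≈ : ∀ {x y} → x - y ≈ 0ℤ → x ≈ y
  ≈0⇒≈ {x} {y} (∣⇒≈ n∣[x-y]-0) = ∣⇒≈ (≡.subst (+ n ∣_) (ℤ.+-identityʳ (x - y)) n∣[x-y]-0)

  ≈⇒≈0 : ∀ {x y} → x ≈ y → x - y ≈ 0ℤ
  ≈⇒≈0 {x} {y} (∣⇒≈ n∣x-y) = ∣⇒≈ (≡.subst (+ n ∣_) (≡.sym (ℤ.+-identityʳ (x - y))) n∣x-y)

  ≈0⇒∣ : ∀ {x} → x ≈ 0ℤ → n ℕ.∣ ∣ x ∣
  ≈0⇒∣ {x} (∣⇒≈ n∣x-0) = ∣⇒∣ᵤ (≡.subst (+ n ∣_) (ℤ.+-identityʳ x) n∣x-0)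

  ∣⇒≈0 : ∀ {x} → n ℕ.∣ ∣ x ∣ → x ≈ 0ℤ
  ∣⇒≈0 {x} n∣x = ∣⇒≈ (≡.subst (+ n ∣_) (≡.sym (ℤ.+-identityʳ x)) (∣ᵤ⇒∣ n∣x))

  *n≈0 : ∀ k → k * + n ≈ 0ℤ
  *n≈0 k = ∣⇒≈ (divides k (ℤ.+-identityʳ (k * + n)))

  n≈0 : + n ≈ 0ℤ
  n≈0 = ≈-trans (≈-reflexive (≡.sym (ℤ.*-identityˡ (+ n)))) (*n≈0 1ℤ)

  +[k*n]≈0 : ∀ k → + (k ℕ.* n) ≈ 0ℤ
  +[k*n]≈0 k = ≈-trans (≈-reflexive (ℤ.pos-* k n)) (*n≈0 (+ k))

  y≈0⇒x*y≈0 : ∀ x {y} → y ≈ 0ℤ → x * y ≈ 0ℤ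
  y≈0⇒x*y≈0 x y≈0 = ≈-trans (*-cong (≈-refl {x}) y≈0) (≈-reflexive (ℤ.*-zeroʳ x))

  ^-cong : ∀ k {x y} → x ≈ y → x ^ k ≈ y ^ k
  ^-cong ℕ.zero    x≈y = ≈-refl
  ^-cong (ℕ.suc k) x≈y = *-cong x≈y (^-cong k x≈y)

  ∑-const : ∀ k c → ∑[ i < k ] c ≡ + k * c
  ∑-const ℕ.zero    c = ≡.sym (ℤ.*-zeroˡ c)
  ∑-const (ℕ.suc k) c = ≡.trans (cong (λ s → c + s) (∑-const k c)) (distrib c (+ k))
    where
    distrib : ∀ c x → c + x * c ≡ (1ℤ + x) * c
    distrib = solve-∀

  x+y≈0⇒[k*x≈1⇒k*y+1≈0] : ∀ k {x y} → x + y ≈ 0ℤ → k * x ≈ 1ℤ → k * y + 1ℤ ≈ 0ℤ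
  x+y≈0⇒[k*x≈1⇒k*y+1≈0] k {x} {y} x+y≈0 kx≈1 = begin
    k * y + 1ℤ     ≈⟨ +-cong (≈-refl {k * y}) (≈-sym kx≈1) ⟩
    k * y + k * x  ≡⟨ factor k x y ⟩
    k * (x + y)    ≈⟨ y≈0⇒x*y≈0 k x+y≈0 ⟩
    0ℤ             ∎
    where
    open ≈-Reasoning
    factor : ∀ k x y → k * y + k * x ≡ k * (x + y)
    factor = solve-∀

  x+y≈0⇒[k*x+1≈0⇒k*y≈1] : ∀ k {x y} → x + y ≈ 0ℤ → k * x + 1ℤ ≈ 0ℤ → k * y ≈ 1ℤ
  x+y≈0⇒[k*x+1≈0⇒k*y≈1] k {x} {y} x+y≈0 kx+1≈0 = begin
    k * y
      ≡⟨ rearrange k x y ⟩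
    k * (x + y) - (k * x + 1ℤ) + 1ℤ
      ≈⟨ +-cong (+-cong (y≈0⇒x*y≈0 k x+y≈0) (-‿cong kx+1≈0)) (≈-refl {1ℤ}) ⟩
    1ℤ
      ∎
    where
    open ≈-Reasoning
    rearrange : ∀ k x y → k * y ≡ k * (x + y) - (k * x + 1ℤ) + 1ℤ
    rearrange = solve-∀

  ⟦_⟧ : Fin n → ℤ
  ⟦ r ⟧ = + toℕ r

  module _ .{{_ : NonZero n}} where

    private
      ≤∧≈⇒≡ : ∀ {a b} → a ℕ.≤ b → b ℕ.< n → + a ≈ + b → a ≡ b
      ≤∧≈⇒≡ {a} {b} a≤b b<n (∣⇒≈ n∣a-b) = ℕ.≤-antisym a≤b (ℕ.m∸n≡0⇒m≤n b∸a≡0)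
        where
        n∣b∸a : n ℕ.∣ b ∸ a
        n∣b∸a = ≡.subst (n ℕ.∣_) (≡.trans (cong ∣_∣ (ℤ.[+m]-[+n]≡m⊖n a b)) (ℤ.∣⊖∣-≤ a≤b))
                        (∣⇒∣ᵤ n∣a-b)
        b∸a≡0 : b ∸ a ≡ 0
        b∸a≡0 = ≡.trans (≡.sym (m<n⇒m%n≡m (ℕ.≤-<-trans (ℕ.m∸n≤m b a) b<n))) (n∣m⇒m%n≡0 _ n n∣b∸a)

    +≈+⇒≡ : ∀ {a b} → a ℕ.< n → b ℕ.< n → + a ≈ + b → a ≡ b
    +≈+⇒≡ {a} {b} a<n b<n a≈b with ℕ.≤-total a b
    ... | inj₁ a≤b = ≤∧≈⇒≡ a≤b b<n a≈b
    ... | inj₂ b≤a = ≡.sym (≤∧≈⇒≡ b≤a a<n (≈-sym a≈b))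

    ⟦⟧-injective : ∀ {r s : Fin n} → ⟦ r ⟧ ≈ ⟦ s ⟧ → r ≡ s
    ⟦⟧-injective {r} {s} = toℕ-injective ∘ +≈+⇒≡ (toℕ<n r) (toℕ<n s)

    [_] : ℤ → Fin n
    [ x ] = fromℕ< (ℤ.n%ℕd<d x n)

    toℕ-[] : ∀ x → toℕ [ x ] ≡ x %ℕ n
    toℕ-[] x = toℕ-fromℕ< (ℤ.n%ℕd<d x n)

    ⟦[]⟧ : ∀ x → ⟦ [ x ] ⟧ ≈ x
    ⟦[]⟧ x = ∣⇒≈ (divides (- (x /ℕ n)) (begin
      ⟦ [ x ] ⟧ - x                               ≡⟨ cong₂ _-_ (cong +_ (toℕ-[] x)) (ℤ.a≡a%ℕn+[a/ℕn]*n x n) ⟩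
      + (x %ℕ n) - (+ (x %ℕ n) + (x /ℕ n) * + n)  ≡⟨ cancel (+ (x %ℕ n)) (x /ℕ n) (+ n) ⟩
      - (x /ℕ n) * + n                            ∎))
      where
      open ≡.≡-Reasoning
      cancel : ∀ r q m → r - (r + q * m) ≡ - q * m
      cancel = solve-∀

    []-cong : ∀ {x y} → x ≈ y → [ x ] ≡ [ y ]
    []-cong {x} {y} x≈y = ⟦⟧-injective (≈-trans (⟦[]⟧ x) (≈-trans x≈y (≈-sym (⟦[]⟧ y))))

    [⟦⟧] : ∀ r → [ ⟦ r ⟧ ] ≡ r
    [⟦⟧] r = ⟦⟧-injective (⟦[]⟧ ⟦ r ⟧)

    []≡⇔≈⟦⟧ : ∀ {x r} → [ x ] ≡ r ⇔ x ≈ ⟦ r ⟧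
    []≡⇔≈⟦⟧ {x} {r} = mk⇔
      (λ [x]≡r → ≈-trans (≈-sym (⟦[]⟧ x)) (≈-reflexive (cong ⟦_⟧ [x]≡r)))
      (λ x≈r → ≡.trans ([]-cong x≈r) ([⟦⟧] r))

    []≡[]⇔≈ : ∀ {x y} → [ x ] ≡ [ y ] ⇔ x ≈ y
    []≡[]⇔≈ {x} {y} = mk⇔
      (λ [x]≡[y] → ≈-trans (Equivalence.to []≡⇔≈⟦⟧ [x]≡[y]) (⟦[]⟧ y))
      []-cong

    %≡0⇒≈0 : ∀ {a} → a % n ≡ 0 → + a ≈ 0ℤ
    %≡0⇒≈0 {a} a%n≡0 = ∣⇒≈0 (m%n≡0⇒n∣m a n a%n≡0)

    ≈⇒%≡ : ∀ {a b} → + a ≈ + b → a % n ≡ b % n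
    ≈⇒%≡ {a} {b} a≈b = ≡.trans (≡.sym (toℕ-[] (+ a))) (≡.trans (cong toℕ ([]-cong a≈b)) (toℕ-[] (+ b)))

module PrimeField {m : ℕ} (isPrime : Prime (ℕ.suc m)) where

  p : ℕ
  p = ℕ.suc m

  open IntegersModulo p public
  open import Data.Integer.Base using (ℤ; +_; _+_; _*_; -_; _-_; 0ℤ; 1ℤ; ∣_∣; _^_)
  import Data.Integer.Properties as ℤ
  open import Data.Integer.Tactic.RingSolver using (solve-∀)
  open ≈-Reasoning

  ≈0-or-≈0 : ∀ x y → x * y ≈ 0ℤ → x ≈ 0ℤ ⊎ y ≈ 0ℤ
  ≈0-or-≈0 x y xy≈0
    with euclidsLemma ∣ x ∣ ∣ y ∣ isPrime (≡.subst (p ℕ.∣_) (ℤ.abs-* x y) (≈0⇒∣ xy≈0))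
  ... | inj₁ p∣x = inj₁ (∣⇒≈0 p∣x)
  ... | inj₂ p∣y = inj₂ (∣⇒≈0 p∣y)

  *-cancelˡ-≈ : ∀ {z} x y → ¬ (z ≈ 0ℤ) → z * x ≈ z * y → x ≈ y
  *-cancelˡ-≈ {z} x y z≉0 zx≈zy = [ (λ z≈0 → contradiction z≈0 z≉0) , ≈0⇒≈ ]′
    (≈0-or-≈0 z (x - y) (≈-trans (≈-reflexive (distrib z x y)) (≈⇒≈0 zx≈zy)))
    where
    distrib : ∀ z x y → z * (x - y) ≡ z * x - z * y
    distrib = solve-∀

  +≉0 : ∀ {a} → 0 ℕ.< a → a ℕ.< p → ¬ (+ a ≈ 0ℤ)
  +≉0 {a} 0<a a<p a≈0 = ℕ.<⇒≢ 0<a (≡.sym (+≈+⇒≡ a<p (ℕ.<-trans 0<a a<p) a≈0))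

  1≉0 : ¬ (1ℤ ≈ 0ℤ)
  1≉0 = +≉0 ℕ.z<s (ℕ.nonTrivial⇒n>1 p {{prime⇒nonTrivial isPrime}})

  ⟦⟧≉0 : ∀ {r} → r ≢ zero → ¬ (⟦ r ⟧ ≈ 0ℤ)
  ⟦⟧≉0 r≢0 = r≢0 ∘ ⟦⟧-injective

  inverse : ∀ t .{{_ : NonZero t}} → t ℕ.< p → ∃ λ y → y * + t ≈ 1ℤ
  inverse t t<p with coprime-Bézout (prime⇒coprime isPrime t<p)
  ... | Bézout.+- x y 1+yt≡xp = - + y , (begin
    - + y * + t
      ≡⟨ rearrange (+ y) (+ t) ⟩
    1ℤ - (1ℤ + + y * + t)
      ≡⟨ cong (λ z → 1ℤ - z) (≡.trans (ℤ.pos-+ 1 (y ℕ.* t)) (cong (λ z → 1ℤ + z) (ℤ.pos-* y t))) ⟨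
    1ℤ - + (1 ℕ.+ y ℕ.* t)
      ≈⟨ +-cong (≈-refl {1ℤ}) (-‿cong (≈-trans (≈-reflexive (cong +_ 1+yt≡xp)) (+[k*n]≈0 x))) ⟩
    1ℤ
      ∎)
    where
    rearrange : ∀ y t → - y * t ≡ 1ℤ - (1ℤ + y * t)
    rearrange = solve-∀
  ... | Bézout.-+ x y 1+xp≡yt = + y , (begin
    + y * + t          ≡⟨ ℤ.pos-* y t ⟨
    + (y ℕ.* t)        ≡⟨ cong +_ 1+xp≡yt ⟨
    + (1 ℕ.+ x ℕ.* p)  ≡⟨ ℤ.pos-+ 1 (x ℕ.* p) ⟩
    1ℤ + + (x ℕ.* p)   ≈⟨ +-cong (≈-refl {1ℤ}) (+[k*n]≈0 x) ⟩
    1ℤ                 ∎)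

  -- inv zero = zero is a junk value; it makes inv an involution of the whole of Fin p.

  inv : Fin p → Fin p
  inv zero      = zero
  inv r@(suc _) = [ proj₁ (inverse (toℕ r) (toℕ<n r)) ]

  inv-inverse : ∀ {r} → r ≢ zero → ⟦ inv r ⟧ * ⟦ r ⟧ ≈ 1ℤ
  inv-inverse {zero}      r≢0 = contradiction ≡.refl r≢0
  inv-inverse {r@(suc _)} _ with inverse (toℕ r) (toℕ<n r)
  ... | y , y*r≈1 = ≈-trans (*-cong (⟦[]⟧ y) (≈-refl {⟦ r ⟧})) y*r≈1

  inv-unique : ∀ {r} x → r ≢ zero → x * ⟦ r ⟧ ≈ 1ℤ → x ≈ ⟦ inv r ⟧
  inv-unique {r} x r≢0 xr≈1 = *-cancelˡ-≈ x ⟦ inv r ⟧ (⟦⟧≉0 r≢0) (begin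
    ⟦ r ⟧ * x          ≡⟨ ℤ.*-comm ⟦ r ⟧ x ⟩
    x * ⟦ r ⟧          ≈⟨ xr≈1 ⟩
    1ℤ                 ≈⟨ inv-inverse r≢0 ⟨
    ⟦ inv r ⟧ * ⟦ r ⟧  ≡⟨ ℤ.*-comm ⟦ inv r ⟧ ⟦ r ⟧ ⟩
    ⟦ r ⟧ * ⟦ inv r ⟧  ∎)

  inv≢zero : ∀ {r} → r ≢ zero → inv r ≢ zero
  inv≢zero {r} r≢0 inv-r≡0 = 1≉0 (begin
    1ℤ                 ≈⟨ inv-inverse r≢0 ⟨
    ⟦ inv r ⟧ * ⟦ r ⟧  ≡⟨ cong (λ s → ⟦ s ⟧ * ⟦ r ⟧) inv-r≡0 ⟩
    0ℤ * ⟦ r ⟧         ≡⟨ ℤ.*-zeroˡ ⟦ r ⟧ ⟩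
    0ℤ                 ∎)

  inv-involutive : ∀ r → inv (inv r) ≡ r
  inv-involutive zero      = ≡.refl
  inv-involutive r@(suc _) = ⟦⟧-injective (≈-sym (inv-unique ⟦ r ⟧ (inv≢zero r≢0)
    (≈-trans (≈-reflexive (ℤ.*-comm ⟦ r ⟧ ⟦ inv r ⟧)) (inv-inverse r≢0))))
    where
    r≢0 : r ≢ zero
    r≢0 ()

  residueMap : (ℤ → ℤ) → Fin p → Fin p
  residueMap φ r = [ φ ⟦ r ⟧ ]

  residueMap-inverse : ∀ φ ψ → (∀ {x y} → x ≈ y → φ x ≈ φ y) → (∀ x → φ (ψ x) ≈ x) →
                       ∀ r → residueMap φ (residueMap ψ r) ≡ r
  residueMap-inverse φ ψ φ-cong φψ≈id r =
    ≡.trans ([]-cong (≈-trans (φ-cong (⟦[]⟧ (ψ ⟦ r ⟧))) (φψ≈id ⟦ r ⟧))) ([⟦⟧] r)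

  translation : ℤ → Permutation p p
  translation c = permutation (residueMap (_+ c)) (residueMap (_- c))
    (residueMap-inverse (_+ c) (_- c) (λ x≈y → +-cong x≈y ≈-refl) (λ x → ≈-reflexive (cancel₁ x c)))
    (residueMap-inverse (_- c) (_+ c) (λ x≈y → +-cong x≈y ≈-refl) (λ x → ≈-reflexive (cancel₂ x c)))
    where
    cancel₁ : ∀ x c → x - c + c ≡ x
    cancel₁ = solve-∀
    cancel₂ : ∀ x c → x + c - c ≡ x
    cancel₂ = solve-∀

  scaling : (c : Fin p) → c ≢ zero → Permutation p p
  scaling c c≢0 = permutation (residueMap (⟦ c ⟧ *_)) (residueMap (⟦ inv c ⟧ *_))
    (residueMap-inverse (⟦ c ⟧ *_) (⟦ inv c ⟧ *_) (*-cong (≈-refl {⟦ c ⟧}))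
                        (cancel ⟦ c ⟧ ⟦ inv c ⟧ c⁻¹c≈1))
    (residueMap-inverse (⟦ inv c ⟧ *_) (⟦ c ⟧ *_) (*-cong (≈-refl {⟦ inv c ⟧}))
                        (cancel ⟦ inv c ⟧ ⟦ c ⟧ cc⁻¹≈1))
    where
    c⁻¹c≈1 : ⟦ inv c ⟧ * ⟦ c ⟧ ≈ 1ℤ
    c⁻¹c≈1 = inv-inverse c≢0
    cc⁻¹≈1 : ⟦ c ⟧ * ⟦ inv c ⟧ ≈ 1ℤ
    cc⁻¹≈1 = ≈-trans (≈-reflexive (ℤ.*-comm ⟦ c ⟧ ⟦ inv c ⟧)) c⁻¹c≈1
    reassoc : ∀ a b x → a * (b * x) ≡ (b * a) * x
    reassoc = solve-∀
    cancel : ∀ a b → b * a ≈ 1ℤ → ∀ x → a * (b * x) ≈ x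
    cancel a b ba≈1 x = ≈-trans (≈-reflexive (reassoc a b x))
                        (≈-trans (*-cong ba≈1 (≈-refl {x})) (≈-reflexive (ℤ.*-identityˡ x)))

  inversion : Permutation p p
  inversion = permutation inv inv inv-involutive inv-involutive

  ∑-translate : ∀ c (g : Fin p → ℤ) → ∑[ x < p ] g x ≈ ∑[ x < p ] g [ ⟦ x ⟧ + c ]
  ∑-translate c g = ∑-permute g (translation c)

  ∑-scale : ∀ {c} → c ≢ zero → (g : Fin p → ℤ) → ∑[ x < p ] g x ≈ ∑[ x < p ] g [ ⟦ c ⟧ * ⟦ x ⟧ ]
  ∑-scale c≢0 g = ∑-permute g (scaling _ c≢0)

  ∑-inv : (g : Fin p → ℤ) → ∑[ x < p ] g x ≈ ∑[ x < p ] g (inv x)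
  ∑-inv g = ∑-permute g inversion

  ^-distrib-* : ∀ x y k → (x * y) ^ k ≡ x ^ k * y ^ k
  ^-distrib-* x y ℕ.zero    = ≡.refl
  ^-distrib-* x y (ℕ.suc k) =
    ≡.trans (cong ((x * y) *_) (^-distrib-* x y k)) (interchange x y (x ^ k) (y ^ k))
    where
    interchange : ∀ x y a b → (x * y) * (a * b) ≡ (x * a) * (y * b)
    interchange = solve-∀

  ∑-pow≈0 : ∀ k {c} → c ≢ zero → ¬ (⟦ c ⟧ ^ k ≈ 1ℤ) → ∑[ x < p ] (⟦ x ⟧ ^ k) ≈ 0ℤ
  ∑-pow≈0 k {c} c≢0 cᵏ≉1 = [ (λ cᵏ-1≈0 → contradiction (≈0⇒≈ cᵏ-1≈0) cᵏ≉1) , id ]′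
    (≈0-or-≈0 (⟦ c ⟧ ^ k - 1ℤ) Σ (≈-trans (≈-reflexive (factor (⟦ c ⟧ ^ k) Σ)) (≈⇒≈0 (≈-sym Σ≈cᵏΣ))))
    where
    Σ : ℤ
    Σ = ∑[ x < p ] (⟦ x ⟧ ^ k)
    factor : ∀ a s → (a - 1ℤ) * s ≡ a * s - s
    factor = solve-∀
    Σ≈cᵏΣ : Σ ≈ ⟦ c ⟧ ^ k * Σ
    Σ≈cᵏΣ = begin
      Σ                                      ≈⟨ ∑-scale c≢0 (λ x → ⟦ x ⟧ ^ k) ⟩
      ∑[ x < p ] (⟦ [ ⟦ c ⟧ * ⟦ x ⟧ ] ⟧ ^ k)  ≈⟨ sum-cong-≋ (λ x → ^-cong k (⟦[]⟧ (⟦ c ⟧ * ⟦ x ⟧))) ⟩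
      ∑[ x < p ] ((⟦ c ⟧ * ⟦ x ⟧) ^ k)       ≡⟨ sum-cong-≗ (λ x → ^-distrib-* ⟦ c ⟧ ⟦ x ⟧ k) ⟩
      ∑[ x < p ] (⟦ c ⟧ ^ k * ⟦ x ⟧ ^ k)     ≈⟨ *-distribˡ-sum (⟦ c ⟧ ^ k) (λ x → ⟦ x ⟧ ^ k) ⟨
      ⟦ c ⟧ ^ k * Σ                          ∎

module OddPrimeField {m : ℕ} (isPrime : Prime (ℕ.suc m)) (2<p : 2 ℕ.< ℕ.suc m) where

  open PrimeField isPrime public
  open import Data.Integer.Base using (ℤ; +_; _+_; _*_; -_; _-_; 0ℤ; 1ℤ; _%ℕ_)
  import Data.Integer.Properties as ℤ
  open import Data.Integer.Tactic.RingSolver using (solve-∀)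
  open ≈-Reasoning

  2≉0 : ¬ (+ 2 ≈ 0ℤ)
  2≉0 = +≉0 ℕ.z<s 2<p

  two : Fin p
  two = fromℕ< 2<p

  two≢zero : two ≢ zero
  two≢zero two≡0 = ℕ.1+n≢0 (≡.trans (≡.sym (toℕ-fromℕ< 2<p)) (cong toℕ two≡0))

  ⟦two⟧ : ⟦ two ⟧ ≡ + 2
  ⟦two⟧ = cong +_ (toℕ-fromℕ< 2<p)

  ½ : ℤ
  ½ = ⟦ inv two ⟧

  ½*2≈1 : ½ * + 2 ≈ 1ℤ
  ½*2≈1 = ≈-trans (≈-reflexive (cong (½ *_) (≡.sym ⟦two⟧))) (inv-inverse two≢zero)

  sq : Fin p → Fin p
  sq x = [ ⟦ x ⟧ * ⟦ x ⟧ ]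

  neg : Fin p → Fin p
  neg w = [ - ⟦ w ⟧ ]

  sq-zero : sq zero ≡ zero
  sq-zero = [⟦⟧] zero

  sq-neg : ∀ w → sq (neg w) ≡ sq w
  sq-neg w = []-cong (begin
    ⟦ neg w ⟧ * ⟦ neg w ⟧  ≈⟨ *-cong (⟦[]⟧ (- ⟦ w ⟧)) (⟦[]⟧ (- ⟦ w ⟧)) ⟩
    - ⟦ w ⟧ * - ⟦ w ⟧      ≡⟨ neg*neg ⟦ w ⟧ ⟩
    ⟦ w ⟧ * ⟦ w ⟧          ∎)
    where
    neg*neg : ∀ x → - x * - x ≡ x * x
    neg*neg = solve-∀

  neg-≢ : ∀ {w} → w ≢ zero → w ≢ neg w
  neg-≢ {w} w≢0 w≡neg-w = ⟦⟧≉0 w≢0 (*-cancelˡ-≈ ⟦ w ⟧ 0ℤ 2≉0 (begin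
    + 2 * ⟦ w ⟧      ≡⟨ double ⟦ w ⟧ ⟩
    ⟦ w ⟧ + ⟦ w ⟧    ≈⟨ +-cong (≈-refl {⟦ w ⟧}) (≈-sym -w≈w) ⟩
    ⟦ w ⟧ + - ⟦ w ⟧  ≡⟨ ℤ.+-inverseʳ ⟦ w ⟧ ⟩
    0ℤ               ≡⟨ ℤ.*-zeroʳ (+ 2) ⟨
    + 2 * 0ℤ         ∎))
    where
    -w≈w : - ⟦ w ⟧ ≈ ⟦ w ⟧
    -w≈w = Equivalence.to []≡⇔≈⟦⟧ (≡.sym w≡neg-w)
    double : ∀ x → + 2 * x ≡ x + x
    double = solve-∀

  sq≡sq⇒≡⊎≡neg : ∀ {x w} → sq x ≡ sq w → x ≡ w ⊎ x ≡ neg w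
  sq≡sq⇒≡⊎≡neg {x} {w} sq-x≡sq-w = Data.Sum.map
    (λ x-w≈0 → ⟦⟧-injective (≈0⇒≈ x-w≈0))
    (λ x+w≈0 → ≡.sym (Equivalence.from []≡⇔≈⟦⟧ (≈-sym (x+w≈0⇒x≈-w x+w≈0))))
    (≈0-or-≈0 (⟦ x ⟧ - ⟦ w ⟧) (⟦ x ⟧ + ⟦ w ⟧) (≈-trans (≈-reflexive (difference-of-squares ⟦ x ⟧ ⟦ w ⟧))
      (≈⇒≈0 (Equivalence.to ([]≡[]⇔≈ {⟦ x ⟧ * ⟦ x ⟧} {⟦ w ⟧ * ⟦ w ⟧}) sq-x≡sq-w))))
    where
    difference-of-squares : ∀ x w → (x - w) * (x + w) ≡ x * x - w * w
    difference-of-squares = solve-∀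
    x+w≈0⇒x≈-w : ⟦ x ⟧ + ⟦ w ⟧ ≈ 0ℤ → ⟦ x ⟧ ≈ - ⟦ w ⟧
    x+w≈0⇒x≈-w x+w≈0 =
      ≈0⇒≈ (≈-trans (≈-reflexive (cong (λ z → ⟦ x ⟧ + z) (ℤ.neg-involutive ⟦ w ⟧))) x+w≈0)

  δ-sq : ∀ {w} → w ≢ zero → ∀ x → δ (sq x) (sq w) ≈ δ x w + δ x (neg w)
  δ-sq {w} w≢0 x = 𝟙-⊎ (x ≟ w) (x ≟ neg w) (sq x ≟ sq w)
    (λ x≡w x≡neg-w → neg-≢ w≢0 (≡.trans (≡.sym x≡w) x≡neg-w))
    (mk⇔ sq≡sq⇒≡⊎≡neg [ cong sq , (λ x≡neg-w → ≡.trans (cong sq x≡neg-w) (sq-neg w)) ]′)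

  roots : Fin p → ℤ
  roots a = ∑[ x < p ] δ (sq x) a

  roots-sq : ∀ {w} → w ≢ zero → roots (sq w) ≈ + 2
  roots-sq {w} w≢0 = begin
    ∑[ x < p ] δ (sq x) (sq w)                 ≈⟨ sum-cong-≋ (δ-sq w≢0) ⟩
    ∑[ x < p ] (δ x w + δ x (neg w))           ≈⟨ ∑-distrib-+ (λ x → δ x w) (λ x → δ x (neg w)) ⟩
    ∑[ x < p ] δ x w + ∑[ x < p ] δ x (neg w)  ≈⟨ +-cong (∑-δ≈1 w) (∑-δ≈1 (neg w)) ⟩
    + 2                                        ∎

  roots-nonsquare : ∀ {a} → (∀ w → sq w ≢ a) → roots a ≈ 0ℤ
  roots-nonsquare {a} ¬square = begin
    ∑[ x < p ] δ (sq x) a  ≡⟨ sum-cong-≗ (λ x → δ-≢ (¬square x)) ⟩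
    ∑[ x < p ] 0ℤ          ≈⟨ sum-replicate-zero p ⟩
    0ℤ                     ∎

  χ : Fin p → ℤ
  χ a = 𝟙 (IsQR? p (toℕ a))

  toℕ-sq : ∀ x → toℕ (sq x) ≡ (toℕ x ℕ.* toℕ x) % p
  toℕ-sq x = ≡.trans (toℕ-[] (⟦ x ⟧ * ⟦ x ⟧)) (cong (_%ℕ p) (≡.sym (ℤ.pos-* (toℕ x) (toℕ x))))

  toℕ%p : ∀ a → toℕ a % p ≡ toℕ a
  toℕ%p a = m<n⇒m%n≡m (toℕ<n a)

  IsQR⇔square : ∀ {a} → a ≢ zero → IsQR p (toℕ a) ⇔ ∃ λ w → sq w ≡ a
  IsQR⇔square {a} a≢0 = mk⇔
    (λ (_ , w , w²≡a) → w , toℕ-injective (≡.trans (toℕ-sq w) (≡.trans w²≡a (toℕ%p a))))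
    (λ (w , sq-w≡a) → (λ a%p≡0 → a≢0 (toℕ-injective (≡.trans (≡.sym (toℕ%p a)) a%p≡0))) ,
                       w , ≡.trans (≡.sym (toℕ-sq w)) (≡.trans (cong toℕ sq-w≡a) (≡.sym (toℕ%p a))))

  roots≈2χ : ∀ {a} → a ≢ zero → roots a ≈ + 2 * χ a
  roots≈2χ {a} a≢0 with IsQR? p (toℕ a)
  ... | yes qr = roots-of-square (Equivalence.to (IsQR⇔square a≢0) qr)
    where
    roots-of-square : (∃ λ w → sq w ≡ a) → roots a ≈ + 2 * χ a
    roots-of-square (w , sq-w≡a) = begin
      roots a       ≡⟨ cong roots sq-w≡a ⟨
      roots (sq w)  ≈⟨ roots-sq w≢0 ⟩
      + 2 * 1ℤ      ≡⟨ cong (+ 2 *_) (𝟙-yes (IsQR? p (toℕ a)) qr) ⟨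
      + 2 * χ a     ∎
      where
      w≢0 : w ≢ zero
      w≢0 w≡0 = a≢0 (≡.trans (≡.sym sq-w≡a) (≡.trans (cong sq w≡0) sq-zero))
  ... | no ¬qr = begin
    roots a    ≈⟨ roots-nonsquare (λ w sq-w≡a → ¬qr (Equivalence.from (IsQR⇔square a≢0) (w , sq-w≡a))) ⟩
    + 2 * 0ℤ   ≡⟨ cong (+ 2 *_) (𝟙-no (IsQR? p (toℕ a)) ¬qr) ⟨
    + 2 * χ a  ∎

  ∑-sq : (G : Fin p → ℤ) → G zero ≈ 0ℤ → ∑[ x < p ] G (sq x) ≈ ∑[ a < p ] (+ 2 * χ a * G a)
  ∑-sq G G0≈0 = begin
    ∑[ x < p ] G (sq x)           ≈⟨ ∑-fibres sq G ⟩
    ∑[ a < p ] (roots a * G a)    ≈⟨ sum-cong-≋ weight ⟩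
    ∑[ a < p ] (+ 2 * χ a * G a)  ∎
    where
    weight : ∀ a → roots a * G a ≈ + 2 * χ a * G a
    weight zero      = ≈-trans (y≈0⇒x*y≈0 (roots zero) G0≈0) (≈-sym (y≈0⇒x*y≈0 (+ 2 * χ zero) G0≈0))
    weight a@(suc _) = *-cong (roots≈2χ {a} (λ ())) (≈-refl {G a})

  -- The x-coordinate of the point of y² = x² + 1 with y - x = u (so y + x = u⁻¹).

  conicX : Fin p → Fin p
  conicX u = [ (⟦ inv u ⟧ - ⟦ u ⟧) * ½ ]

  2u·conicX≈1-u² : ∀ {u} → u ≢ zero → + 2 * ⟦ u ⟧ * ⟦ conicX u ⟧ ≈ 1ℤ - ⟦ u ⟧ * ⟦ u ⟧
  2u·conicX≈1-u² {u} u≢0 = begin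
    + 2 * ⟦ u ⟧ * ⟦ conicX u ⟧
      ≈⟨ *-cong (≈-refl {+ 2 * ⟦ u ⟧}) (⟦[]⟧ ((⟦ inv u ⟧ - ⟦ u ⟧) * ½)) ⟩
    + 2 * ⟦ u ⟧ * ((⟦ inv u ⟧ - ⟦ u ⟧) * ½)
      ≡⟨ expand ⟦ u ⟧ ⟦ inv u ⟧ ½ ⟩
    (½ * + 2) * (⟦ inv u ⟧ * ⟦ u ⟧ - ⟦ u ⟧ * ⟦ u ⟧)
      ≈⟨ *-cong ½*2≈1 (+-cong (inv-inverse u≢0) (≈-refl { - (⟦ u ⟧ * ⟦ u ⟧)})) ⟩
    1ℤ * (1ℤ - ⟦ u ⟧ * ⟦ u ⟧)
      ≡⟨ ℤ.*-identityˡ (1ℤ - ⟦ u ⟧ * ⟦ u ⟧) ⟩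
    1ℤ - ⟦ u ⟧ * ⟦ u ⟧
      ∎
    where
    expand : ∀ u i h → + 2 * u * ((i - u) * h) ≡ (h * + 2) * (i * u - u * u)
    expand = solve-∀

  on-conic⇔ : ∀ {u} → u ≢ zero → ∀ x →
              sq [ ⟦ u ⟧ + ⟦ x ⟧ ] ≡ [ ⟦ x ⟧ * ⟦ x ⟧ + 1ℤ ] ⇔ conicX u ≡ x
  on-conic⇔ {u} u≢0 x = mk⇔ on-conic⇒ on-conic⇐
    where
    a z X : ℤ
    a = ⟦ u ⟧
    z = ⟦ x ⟧
    X = ⟦ conicX u ⟧
    expand : ∀ a z → (a + z) * (a + z) ≡ (z * z + a * a) + + 2 * a * z
    expand = solve-∀
    difference : ∀ a z → (a + z) * (a + z) - (z * z + a * a) ≡ + 2 * a * z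
    difference = solve-∀
    cancel : ∀ a z → (z * z + 1ℤ) - (z * z + a * a) ≡ 1ℤ - a * a
    cancel = solve-∀
    cancel′ : ∀ a z → (z * z + a * a) + (1ℤ - a * a) ≡ z * z + 1ℤ
    cancel′ = solve-∀
    2a≉0 : ¬ (+ 2 * a ≈ 0ℤ)
    2a≉0 2a≈0 = [ 2≉0 , ⟦⟧≉0 u≢0 ]′ (≈0-or-≈0 (+ 2) a 2a≈0)
    square≈ : ⟦ [ a + z ] ⟧ * ⟦ [ a + z ] ⟧ ≈ (a + z) * (a + z)
    square≈ = *-cong (⟦[]⟧ (a + z)) (⟦[]⟧ (a + z))
    on-conic⇒ : sq [ a + z ] ≡ [ z * z + 1ℤ ] → conicX u ≡ x
    on-conic⇒ on-conic = ⟦⟧-injective (≈-sym (*-cancelˡ-≈ z X 2a≉0 (begin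
      + 2 * a * z                          ≡⟨ difference a z ⟨
      (a + z) * (a + z) - (z * z + a * a)  ≈⟨ +-cong [a+z]²≈z²+1 (≈-refl { - (z * z + a * a)}) ⟩
      (z * z + 1ℤ) - (z * z + a * a)       ≡⟨ cancel a z ⟩
      1ℤ - a * a                           ≈⟨ 2u·conicX≈1-u² u≢0 ⟨
      + 2 * a * X                          ∎)))
      where
      [a+z]²≈z²+1 : (a + z) * (a + z) ≈ z * z + 1ℤ
      [a+z]²≈z²+1 = ≈-trans (≈-sym square≈)
        (Equivalence.to ([]≡[]⇔≈ {⟦ [ a + z ] ⟧ * ⟦ [ a + z ] ⟧} {z * z + 1ℤ}) on-conic)
    on-conic⇐ : conicX u ≡ x → sq [ a + z ] ≡ [ z * z + 1ℤ ]
    on-conic⇐ conicX-u≡x = Equivalence.from []≡[]⇔≈ (begin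
      ⟦ [ a + z ] ⟧ * ⟦ [ a + z ] ⟧   ≈⟨ square≈ ⟩
      (a + z) * (a + z)               ≡⟨ expand a z ⟩
      (z * z + a * a) + + 2 * a * z   ≈⟨ +-cong (≈-refl {z * z + a * a}) (*-cong (≈-refl {+ 2 * a}) z≈X) ⟩
      (z * z + a * a) + + 2 * a * X   ≈⟨ +-cong (≈-refl {z * z + a * a}) (2u·conicX≈1-u² u≢0) ⟩
      (z * z + a * a) + (1ℤ - a * a)  ≡⟨ cancel′ a z ⟩
      z * z + 1ℤ                      ∎)
      where
      z≈X : z ≈ X
      z≈X = ≈-reflexive (cong ⟦_⟧ (≡.sym conicX-u≡x))

  off-conic : ∀ x → sq [ 0ℤ + ⟦ x ⟧ ] ≢ [ ⟦ x ⟧ * ⟦ x ⟧ + 1ℤ ]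
  off-conic x on-conic = 1≉0 (begin
    1ℤ                    ≡⟨ cancel z ⟨
    (z * z + 1ℤ) - z * z  ≈⟨ +-cong z²+1≈z² (≈-refl { - (z * z)}) ⟩
    z * z - z * z         ≡⟨ ℤ.+-inverseʳ (z * z) ⟩
    0ℤ                    ∎)
    where
    z : ℤ
    z = ⟦ x ⟧
    cancel : ∀ z → (z * z + 1ℤ) - z * z ≡ 1ℤ
    cancel = solve-∀
    z²+1≈z² : z * z + 1ℤ ≈ z * z
    z²+1≈z² = ≈-sym (≈-trans (*-cong (≈-sym (⟦[]⟧ (0ℤ + z))) (≈-sym (⟦[]⟧ (0ℤ + z))))
                (Equivalence.to ([]≡[]⇔≈ {⟦ [ 0ℤ + z ] ⟧ * ⟦ [ 0ℤ + z ] ⟧} {z * z + 1ℤ}) on-conic))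

  -- Substituting y = u + x, the equation y² = x² + 1 becomes linear in x for each u ≠ 0.

  ∑-conic : (g : Fin p → ℤ) →
            ∑[ x < p ] (roots [ ⟦ x ⟧ * ⟦ x ⟧ + 1ℤ ] * g x) ≈ ∑[ i < m ] g (conicX (suc i))
  ∑-conic g = begin
    ∑[ x < p ] (roots (c x) * g x)
      ≈⟨ sum-cong-≋ (λ x → *-cong (∑-translate ⟦ x ⟧ (λ y → δ (sq y) (c x))) (≈-refl {g x})) ⟩
    ∑[ x < p ] ((∑[ u < p ] F u x) * g x)
      ≈⟨ sum-cong-≋ (λ x → *-distribʳ-sum (g x) (λ u → F u x)) ⟩
    ∑[ x < p ] ∑[ u < p ] (F u x * g x)
      ≈⟨ ∑-comm (λ x u → F u x * g x) ⟩
    ∑[ u < p ] ∑[ x < p ] (F u x * g x)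
      ≈⟨ +-cong off-conic-sum (sum-cong-≋ (λ i → on-conic-sum (suc i) (λ ()))) ⟩
    0ℤ + ∑[ i < m ] g (conicX (suc i))
      ≡⟨ ℤ.+-identityˡ (∑[ i < m ] g (conicX (suc i))) ⟩
    ∑[ i < m ] g (conicX (suc i))
      ∎
    where
    c : Fin p → Fin p
    c x = [ ⟦ x ⟧ * ⟦ x ⟧ + 1ℤ ]
    F : Fin p → Fin p → ℤ
    F u x = δ (sq [ ⟦ u ⟧ + ⟦ x ⟧ ]) (c x)
    off-conic-sum : ∑[ x < p ] (F zero x * g x) ≈ 0ℤ
    off-conic-sum = begin
      ∑[ x < p ] (F zero x * g x)  ≡⟨ sum-cong-≗ (λ x → cong (_* g x) (δ-≢ (off-conic x))) ⟩
      ∑[ x < p ] (0ℤ * g x)        ≡⟨ sum-cong-≗ (λ x → ℤ.*-zeroˡ (g x)) ⟩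
      ∑[ x < p ] 0ℤ                ≈⟨ sum-replicate-zero p ⟩
      0ℤ                           ∎
    on-conic-sum : ∀ u → u ≢ zero → ∑[ x < p ] (F u x * g x) ≈ g (conicX u)
    on-conic-sum u u≢0 = begin
      ∑[ x < p ] (F u x * g x)
        ≡⟨ sum-cong-≗ (λ x → cong (_* g x) (F≡δ x)) ⟩
      ∑[ x < p ] (δ (conicX u) x * g x)
        ≈⟨ ∑-δ (conicX u) g ⟩
      g (conicX u)
        ∎
      where
      F≡δ : ∀ x → F u x ≡ δ (conicX u) x
      F≡δ x = 𝟙-cong (sq [ ⟦ u ⟧ + ⟦ x ⟧ ] ≟ c x) (conicX u ≟ x) (on-conic⇔ u≢0 x)

module ConsecutiveResidueSums {m : ℕ} (isPrime : Prime (ℕ.suc m)) (7≤p : 7 ℕ.≤ ℕ.suc m) where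

  private
    <7⇒<p : ∀ {k} → k ℕ.< 7 → k ℕ.< ℕ.suc m
    <7⇒<p k<7 = ℕ.<-≤-trans k<7 7≤p

  open OddPrimeField isPrime (<7⇒<p (ℕ.s≤s (ℕ.s≤s (ℕ.s≤s ℕ.z≤n)))) public
  open import Data.Integer.Base using (ℤ; +_; _+_; _*_; -_; _-_; 0ℤ; 1ℤ; _^_)
  import Data.Integer.Properties as ℤ
  open import Data.Integer.Tactic.RingSolver using (solve-∀)
  open import Data.List.Base using (map; filter; applyUpTo)
  open import Data.Nat.ListAction using () renaming (sum to listSum)
  open FilteredSums using (map-applyUpTo; sum-filter-applyUpTo)
  open ≈-Reasoning

  𝟙A : Bool → ℕ → ℤ
  𝟙A i a = 𝟙 (InA? p i a)

  f : ℤ → ℤ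
  f z = z * z + z

  -- The a = 0 term, which A_ij does not contain, vanishes since f 0 = 0.

  T : Bool → Bool → ℤ
  T i j = ∑[ a < p ] (𝟙A i (toℕ a) * 𝟙A j (toℕ a ℕ.+ 1) * f ⟦ a ⟧)

  S≈T : ∀ i j → + S p i j ≈ T i j
  S≈T i j = begin
    + S p i j
      ≡⟨ cong (λ as → + listSum (map g (filter Q? as))) (map-applyUpTo ℕ.suc id m) ⟩
    + listSum (map g (filter Q? (applyUpTo ℕ.suc m)))
      ≡⟨ sum-filter-applyUpTo Q? g ℕ.suc m ⟩
    ∑[ k < m ] (𝟙 (Q? (toℕ (suc k))) * + g (toℕ (suc k)))
      ≈⟨ sum-cong-≋ (λ k → term (suc k)) ⟩
    ∑[ k < m ] (t (suc k))
      ≡⟨ ℤ.+-identityˡ (∑[ k < m ] (t (suc k))) ⟨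
    0ℤ + ∑[ k < m ] (t (suc k))
      ≡⟨ cong (_+ ∑[ k < m ] (t (suc k))) (ℤ.*-zeroʳ (𝟙A i 0 * 𝟙A j 1)) ⟨
    T i j
      ∎
    where
    Q? : Decidable (λ a → InA p i a × InA p j (a ℕ.+ 1))
    Q? a = InA? p i a ×-dec InA? p j (a ℕ.+ 1)
    g : ℕ → ℕ
    g a = a ℕ.* a ℕ.+ a
    t : Fin p → ℤ
    t a = 𝟙A i (toℕ a) * 𝟙A j (toℕ a ℕ.+ 1) * f ⟦ a ⟧
    term : ∀ a → 𝟙 (Q? (toℕ a)) * + g (toℕ a) ≈ t a
    term a = *-cong (𝟙-×-dec (InA? p i (toℕ a)) (InA? p j (toℕ a ℕ.+ 1))) (≈-reflexive
      (≡.trans (ℤ.pos-+ (toℕ a ℕ.* toℕ a) (toℕ a)) (cong (_+ ⟦ a ⟧) (ℤ.pos-* (toℕ a) (toℕ a)))))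

  InA-resp-% : ∀ i {b c} → b % p ≡ c % p → InA p i b → InA p i c
  InA-resp-% false b≡c (b≢0 , x , x²≡b) = (λ c≡0 → b≢0 (≡.trans b≡c c≡0)) , x , ≡.trans x²≡b b≡c
  InA-resp-% true  b≡c (b≢0 , ¬square)  = (λ c≡0 → b≢0 (≡.trans b≡c c≡0)) ,
                                            (λ (x , x²≡c) → ¬square (x , ≡.trans x²≡c (≡.sym b≡c)))

  𝟙A-% : ∀ i b → 𝟙A i (b % p) ≡ 𝟙A i b
  𝟙A-% i b = 𝟙-cong (InA? p i (b % p)) (InA? p i b)
    (mk⇔ (InA-resp-% i (m%n%n≡m%n b p)) (InA-resp-% i (≡.sym (m%n%n≡m%n b p))))

  χ[c+1] : ∀ c → χ [ ⟦ c ⟧ + 1ℤ ] ≡ 𝟙A false (toℕ c ℕ.+ 1)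
  χ[c+1] c = ≡.trans (cong (𝟙A false) (toℕ-[] (⟦ c ⟧ + 1ℤ))) (𝟙A-% false (toℕ c ℕ.+ 1))

  𝟙A-complement : ∀ b → ¬ (b % p ≡ 0) → 𝟙A false b + 𝟙A true b ≈ 1ℤ
  𝟙A-complement b b≢0 = 𝟙-complement (IsQR? p b) (IsQNR? p b)
    (λ (_ , square) (_ , ¬square) → ¬square square)
    (λ ¬qr → b≢0 , λ square → ¬qr (b≢0 , square))

  𝟙A-absorb : ∀ b {z} → (+ b ≈ 0ℤ → z ≈ 0ℤ) → (𝟙A false b + 𝟙A true b) * z ≈ z
  𝟙A-absorb b {z} b≈0⇒z≈0 = by-cases (b % p ℕ.≟ 0)
    where
    by-cases : Dec (b % p ≡ 0) → (𝟙A false b + 𝟙A true b) * z ≈ z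
    by-cases (yes b%p≡0) = ≈-trans (y≈0⇒x*y≈0 (𝟙A false b + 𝟙A true b) z≈0) (≈-sym z≈0)
      where
      z≈0 : z ≈ 0ℤ
      z≈0 = b≈0⇒z≈0 (%≡0⇒≈0 b%p≡0)
    by-cases (no b%p≢0) =
      ≈-trans (*-cong (𝟙A-complement b b%p≢0) (≈-refl {z})) (≈-reflexive (ℤ.*-identityˡ z))

  f-cong : ∀ {x y} → x ≈ y → f x ≈ f y
  f-cong x≈y = +-cong (*-cong x≈y x≈y) x≈y

  f-root : ∀ {x} → x + 1ℤ ≈ 0ℤ → f x ≈ 0ℤ
  f-root {x} x+1≈0 = ≈-trans (≈-reflexive (factor x)) (y≈0⇒x*y≈0 x x+1≈0)
    where
    factor : ∀ x → x * x + x ≡ x * (x + 1ℤ)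
    factor = solve-∀

  T-sumʳ : ∀ i → T i false + T i true ≈ ∑[ a < p ] (𝟙A i (toℕ a) * f ⟦ a ⟧)
  T-sumʳ i = begin
    T i false + T i true
      ≈⟨ ∑-distrib-+ (λ a → x a * y false a * f ⟦ a ⟧) (λ a → x a * y true a * f ⟦ a ⟧) ⟨
    ∑[ a < p ] (x a * y false a * f ⟦ a ⟧ + x a * y true a * f ⟦ a ⟧)
      ≡⟨ sum-cong-≗ (λ a → factor (x a) (y false a) (y true a) (f ⟦ a ⟧)) ⟩
    ∑[ a < p ] (x a * ((y false a + y true a) * f ⟦ a ⟧))
      ≈⟨ sum-cong-≋ (λ a → *-cong (≈-refl {x a}) (𝟙A-absorb (toℕ a ℕ.+ 1) (f-root {⟦ a ⟧}))) ⟩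
    ∑[ a < p ] (x a * f ⟦ a ⟧)
      ∎
    where
    x : Fin p → ℤ
    x a = 𝟙A i (toℕ a)
    y : Bool → Fin p → ℤ
    y j a = 𝟙A j (toℕ a ℕ.+ 1)
    factor : ∀ x y z w → x * y * w + x * z * w ≡ x * ((y + z) * w)
    factor = solve-∀

  T-sumˡ : ∀ j → T false j + T true j ≈ ∑[ a < p ] (𝟙A j (toℕ a ℕ.+ 1) * f ⟦ a ⟧)
  T-sumˡ j = begin
    T false j + T true j
      ≈⟨ ∑-distrib-+ (λ a → x false a * y a * f ⟦ a ⟧) (λ a → x true a * y a * f ⟦ a ⟧) ⟨
    ∑[ a < p ] (x false a * y a * f ⟦ a ⟧ + x true a * y a * f ⟦ a ⟧)
      ≡⟨ sum-cong-≗ (λ a → factor (x false a) (x true a) (y a) (f ⟦ a ⟧)) ⟩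
    ∑[ a < p ] ((x false a + x true a) * (y a * f ⟦ a ⟧))
      ≈⟨ sum-cong-≋ (λ a → 𝟙A-absorb (toℕ a) (y≈0⇒x*y≈0 (y a) ∘ f-cong {⟦ a ⟧} {0ℤ})) ⟩
    ∑[ a < p ] (y a * f ⟦ a ⟧)
      ∎
    where
    x : Bool → Fin p → ℤ
    x i a = 𝟙A i (toℕ a)
    y : Fin p → ℤ
    y a = 𝟙A j (toℕ a ℕ.+ 1)
    factor : ∀ x x′ y z → x * y * z + x′ * y * z ≡ (x + x′) * (y * z)
    factor = solve-∀

  ∑-two-pow : ∀ k → ¬ ((+ 2) ^ k - 1ℤ ≈ 0ℤ) → ∑[ x < p ] (⟦ x ⟧ ^ k) ≈ 0ℤ
  ∑-two-pow k 2ᵏ-1≉0 = ∑-pow≈0 k two≢zero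
    (λ 2ᵏ≈1 → 2ᵏ-1≉0 (≈⇒≈0 (≈-trans (≈-reflexive (cong (_^ k) (≡.sym ⟦two⟧))) 2ᵏ≈1)))

  ∑x≈0 : ∑[ x < p ] ⟦ x ⟧ ≈ 0ℤ
  ∑x≈0 = ≈-trans (≈-reflexive (sum-cong-≗ (λ x → ≡.sym (ℤ.*-identityʳ ⟦ x ⟧)))) (∑-two-pow 1 1≉0)

  ∑x²≈0 : ∑[ x < p ] (⟦ x ⟧ * ⟦ x ⟧) ≈ 0ℤ
  ∑x²≈0 = ≈-trans (≈-reflexive (sum-cong-≗ (λ x → square ⟦ x ⟧)))
                  (∑-two-pow 2 (+≉0 ℕ.z<s (<7⇒<p (ℕ.s≤s (ℕ.s≤s (ℕ.s≤s (ℕ.s≤s ℕ.z≤n)))))))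
    where
    square : ∀ x → x * x ≡ x * (x * 1ℤ)
    square = solve-∀

  ∑x⁴≈0 : ∑[ x < p ] (⟦ x ⟧ ^ 4) ≈ 0ℤ
  ∑x⁴≈0 = ∑-two-pow 4 (λ 15≈0 → [ +≉0 ℕ.z<s 3<p , +≉0 ℕ.z<s 5<p ]′ (≈0-or-≈0 (+ 3) (+ 5) 15≈0))
    where
    3<p : 3 ℕ.< p
    3<p = <7⇒<p (ℕ.s≤s (ℕ.s≤s (ℕ.s≤s (ℕ.s≤s ℕ.z≤n))))
    5<p : 5 ℕ.< p
    5<p = <7⇒<p (ℕ.s≤s (ℕ.s≤s (ℕ.s≤s (ℕ.s≤s (ℕ.s≤s (ℕ.s≤s ℕ.z≤n))))))

  x²x²≡x⁴ : ∀ x → (x * x) * (x * x) ≡ x ^ 4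
  x²x²≡x⁴ = unfolded
    where
    unfolded : ∀ x → (x * x) * (x * x) ≡ x * (x * (x * (x * 1ℤ)))
    unfolded = solve-∀

  ∑f≈0 : ∑[ a < p ] f ⟦ a ⟧ ≈ 0ℤ
  ∑f≈0 = begin
    ∑[ a < p ] f ⟦ a ⟧                             ≈⟨ ∑-distrib-+ (λ a → ⟦ a ⟧ * ⟦ a ⟧) ⟦_⟧ ⟩
    ∑[ a < p ] (⟦ a ⟧ * ⟦ a ⟧) + ∑[ a < p ] ⟦ a ⟧  ≈⟨ +-cong ∑x²≈0 ∑x≈0 ⟩
    0ℤ                                             ∎

  ∑χ[b²+sb]≈0 : ∀ s → ∑[ b < p ] (χ b * (⟦ b ⟧ * ⟦ b ⟧ + s * ⟦ b ⟧)) ≈ 0ℤ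
  ∑χ[b²+sb]≈0 s = *-cancelˡ-≈ (∑[ b < p ] (χ b * h ⟦ b ⟧)) 0ℤ 2≉0 (begin
    + 2 * ∑[ b < p ] (χ b * h ⟦ b ⟧)
      ≈⟨ *-distribˡ-sum (+ 2) (λ b → χ b * h ⟦ b ⟧) ⟩
    ∑[ b < p ] (+ 2 * (χ b * h ⟦ b ⟧))
      ≡⟨ sum-cong-≗ (λ b → ℤ.*-assoc (+ 2) (χ b) (h ⟦ b ⟧)) ⟨
    ∑[ b < p ] (+ 2 * χ b * h ⟦ b ⟧)
      ≈⟨ ∑-sq (h ∘ ⟦_⟧) (≈-reflexive (≡.trans (ℤ.+-identityˡ (s * 0ℤ)) (ℤ.*-zeroʳ s))) ⟨
    ∑[ x < p ] h ⟦ sq x ⟧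
      ≈⟨ sum-cong-≋ (λ x → h-cong (⟦[]⟧ (⟦ x ⟧ * ⟦ x ⟧))) ⟩
    ∑[ x < p ] h (⟦ x ⟧ * ⟦ x ⟧)
      ≈⟨ ∑-distrib-+ (λ x → (⟦ x ⟧ * ⟦ x ⟧) * (⟦ x ⟧ * ⟦ x ⟧)) (λ x → s * (⟦ x ⟧ * ⟦ x ⟧)) ⟩
    ∑[ x < p ] ((⟦ x ⟧ * ⟦ x ⟧) * (⟦ x ⟧ * ⟦ x ⟧)) + ∑[ x < p ] (s * (⟦ x ⟧ * ⟦ x ⟧))
      ≈⟨ +-cong (≈-trans (≈-reflexive (sum-cong-≗ (x²x²≡x⁴ ∘ ⟦_⟧))) ∑x⁴≈0)
                (≈-sym (*-distribˡ-sum s (λ x → ⟦ x ⟧ * ⟦ x ⟧))) ⟩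
    0ℤ + s * ∑[ x < p ] (⟦ x ⟧ * ⟦ x ⟧)
      ≈⟨ +-cong (≈-refl {0ℤ}) (y≈0⇒x*y≈0 s ∑x²≈0) ⟩
    + 2 * 0ℤ
      ∎)
    where
    h : ℤ → ℤ
    h z = z * z + s * z
    h-cong : ∀ {x y} → x ≈ y → h x ≈ h y
    h-cong x≈y = +-cong (*-cong x≈y x≈y) (*-cong (≈-refl {s}) x≈y)

  ∑χf≈0 : ∑[ a < p ] (χ a * f ⟦ a ⟧) ≈ 0ℤ
  ∑χf≈0 = ≈-trans (≈-reflexive (sum-cong-≗ (λ a → cong (λ z → χ a * (⟦ a ⟧ * ⟦ a ⟧ + z))
                                                     (≡.sym (ℤ.*-identityˡ ⟦ a ⟧)))))
                  (∑χ[b²+sb]≈0 1ℤ)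

  ∑χ[a+1]f≈0 : ∑[ a < p ] (𝟙A false (toℕ a ℕ.+ 1) * f ⟦ a ⟧) ≈ 0ℤ
  ∑χ[a+1]f≈0 = begin
    ∑[ a < p ] (𝟙A false (toℕ a ℕ.+ 1) * f ⟦ a ⟧)  ≈⟨ sum-cong-≋ shift ⟩
    ∑[ a < p ] (χ (a+1 a) * h ⟦ a+1 a ⟧)            ≈⟨ ∑-translate 1ℤ (λ b → χ b * h ⟦ b ⟧) ⟨
    ∑[ b < p ] (χ b * h ⟦ b ⟧)                      ≈⟨ ∑χ[b²+sb]≈0 (- 1ℤ) ⟩
    0ℤ                                              ∎
    where
    h : ℤ → ℤ
    h z = z * z + - 1ℤ * z
    a+1 : Fin p → Fin p
    a+1 a = [ ⟦ a ⟧ + 1ℤ ]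
    expand : ∀ z → z * z + z ≡ (z + 1ℤ) * (z + 1ℤ) + - 1ℤ * (z + 1ℤ)
    expand = solve-∀
    shift : ∀ a → 𝟙A false (toℕ a ℕ.+ 1) * f ⟦ a ⟧ ≈ χ (a+1 a) * h ⟦ a+1 a ⟧
    shift a = *-cong (≈-reflexive (≡.sym (χ[c+1] a))) (≈-trans (≈-reflexive (expand ⟦ a ⟧))
      (+-cong (*-cong a+1≈ a+1≈) (*-cong (≈-refl { - 1ℤ}) a+1≈)))
      where
      a+1≈ : ⟦ a ⟧ + 1ℤ ≈ ⟦ a+1 a ⟧
      a+1≈ = ≈-sym (⟦[]⟧ (⟦ a ⟧ + 1ℤ))

  ∑𝟙A₁f≈0 : ∑[ a < p ] (𝟙A true (toℕ a) * f ⟦ a ⟧) ≈ 0ℤ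
  ∑𝟙A₁f≈0 = begin
    N                       ≡⟨ ℤ.+-identityˡ N ⟨
    0ℤ + N                  ≈⟨ +-cong (≈-sym ∑χf≈0) (≈-refl {N}) ⟩
    Q + N                   ≈⟨ ∑-distrib-+ (λ a → χ a * f ⟦ a ⟧) (λ a → 𝟙A true (toℕ a) * f ⟦ a ⟧) ⟨
    ∑[ a < p ] (χ a * f ⟦ a ⟧ + 𝟙A true (toℕ a) * f ⟦ a ⟧)
                            ≡⟨ sum-cong-≗ (λ a → ℤ.*-distribʳ-+ (f ⟦ a ⟧) (χ a) (𝟙A true (toℕ a))) ⟨
    ∑[ a < p ] ((χ a + 𝟙A true (toℕ a)) * f ⟦ a ⟧)
                            ≈⟨ sum-cong-≋ (λ a → 𝟙A-absorb (toℕ a) (f-cong {⟦ a ⟧} {0ℤ})) ⟩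
    ∑[ a < p ] f ⟦ a ⟧      ≈⟨ ∑f≈0 ⟩
    0ℤ                      ∎
    where
    Q N : ℤ
    Q = ∑[ a < p ] (χ a * f ⟦ a ⟧)
    N = ∑[ a < p ] (𝟙A true (toℕ a) * f ⟦ a ⟧)

  χ[·+1]f : Fin p → ℤ
  χ[·+1]f c = 𝟙A false (toℕ c ℕ.+ 1) * f ⟦ c ⟧

  2T₀₀≈∑χ[·+1]f[sq] : + 2 * T false false ≈ ∑[ x < p ] χ[·+1]f (sq x)
  2T₀₀≈∑χ[·+1]f[sq] = begin
    + 2 * T false false
      ≈⟨ *-distribˡ-sum (+ 2) t ⟩
    ∑[ a < p ] (+ 2 * t a)
      ≡⟨ sum-cong-≗ (λ a → reassoc (χ a) (𝟙A false (toℕ a ℕ.+ 1)) (f ⟦ a ⟧)) ⟩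
    ∑[ a < p ] (+ 2 * χ a * χ[·+1]f a)
      ≈⟨ ∑-sq χ[·+1]f (≈-reflexive (ℤ.*-zeroʳ (𝟙A false 1))) ⟨
    ∑[ x < p ] χ[·+1]f (sq x)
      ∎
    where
    t : Fin p → ℤ
    t a = χ a * 𝟙A false (toℕ a ℕ.+ 1) * f ⟦ a ⟧
    reassoc : ∀ x y z → + 2 * (x * y * z) ≡ + 2 * x * (y * z)
    reassoc = solve-∀

  2χ[·+1]f≈roots*f : ∀ c → + 2 * χ[·+1]f c ≈ roots [ ⟦ c ⟧ + 1ℤ ] * f ⟦ c ⟧
  2χ[·+1]f≈roots*f c = by-cases ([ ⟦ c ⟧ + 1ℤ ] ≟ zero)
    where
    by-cases : Dec ([ ⟦ c ⟧ + 1ℤ ] ≡ zero) → + 2 * χ[·+1]f c ≈ roots [ ⟦ c ⟧ + 1ℤ ] * f ⟦ c ⟧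
    by-cases (yes c+1≡0) = ≈-trans (y≈0⇒x*y≈0 (+ 2) (y≈0⇒x*y≈0 (𝟙A false (toℕ c ℕ.+ 1)) f[c]≈0))
                                   (≈-sym (y≈0⇒x*y≈0 (roots [ ⟦ c ⟧ + 1ℤ ]) f[c]≈0))
      where
      f[c]≈0 : f ⟦ c ⟧ ≈ 0ℤ
      f[c]≈0 = f-root {⟦ c ⟧} (Equivalence.to []≡⇔≈⟦⟧ c+1≡0)
    by-cases (no c+1≢0) = begin
      + 2 * χ[·+1]f c                          ≡⟨ ℤ.*-assoc (+ 2) (𝟙A false (toℕ c ℕ.+ 1)) (f ⟦ c ⟧) ⟨
      + 2 * 𝟙A false (toℕ c ℕ.+ 1) * f ⟦ c ⟧   ≡⟨ cong (λ q → + 2 * q * f ⟦ c ⟧) (χ[c+1] c) ⟨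
      + 2 * χ [ ⟦ c ⟧ + 1ℤ ] * f ⟦ c ⟧         ≈⟨ *-cong (roots≈2χ c+1≢0) (≈-refl {f ⟦ c ⟧}) ⟨
      roots [ ⟦ c ⟧ + 1ℤ ] * f ⟦ c ⟧           ∎

  f[x²] : Fin p → ℤ
  f[x²] x = f (⟦ x ⟧ * ⟦ x ⟧)

  4T₀₀≈∑conic : + 4 * T false false ≈ ∑[ i < m ] f[x²] (conicX (suc i))
  4T₀₀≈∑conic = begin
    + 4 * T false false                                  ≡⟨ ℤ.*-assoc (+ 2) (+ 2) (T false false) ⟩
    + 2 * (+ 2 * T false false)                          ≈⟨ *-cong (≈-refl {+ 2}) 2T₀₀≈∑χ[·+1]f[sq] ⟩
    + 2 * ∑[ x < p ] χ[·+1]f (sq x)                      ≈⟨ *-distribˡ-sum (+ 2) (χ[·+1]f ∘ sq) ⟩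
    ∑[ x < p ] (+ 2 * χ[·+1]f (sq x))                    ≈⟨ sum-cong-≋ (2χ[·+1]f≈roots*f ∘ sq) ⟩
    ∑[ x < p ] (roots [ ⟦ sq x ⟧ + 1ℤ ] * f ⟦ sq x ⟧)    ≈⟨ sum-cong-≋ square ⟩
    ∑[ x < p ] (roots [ ⟦ x ⟧ * ⟦ x ⟧ + 1ℤ ] * f[x²] x)  ≈⟨ ∑-conic f[x²] ⟩
    ∑[ i < m ] f[x²] (conicX (suc i))                    ∎
    where
    square : ∀ x → roots [ ⟦ sq x ⟧ + 1ℤ ] * f ⟦ sq x ⟧ ≈ roots [ ⟦ x ⟧ * ⟦ x ⟧ + 1ℤ ] * f[x²] x
    square x = *-cong (≈-reflexive (cong roots ([]-cong (+-cong (⟦[]⟧ (⟦ x ⟧ * ⟦ x ⟧)) (≈-refl {1ℤ})))))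
                      (f-cong (⟦[]⟧ (⟦ x ⟧ * ⟦ x ⟧)))

  -- With d = 2x = u⁻¹ - u and e = u⁻¹u = 1, the left-hand side is P d e; as a polynomial
  -- identity P (a - b) (a b) = a⁴ + b⁴.

  conic-identity : ∀ {u} → u ≢ zero → + 16 * f[x²] (conicX u) + + 2 ≈ ⟦ inv u ⟧ ^ 4 + ⟦ u ⟧ ^ 4
  conic-identity {u} u≢0 = begin
    + 16 * f[x²] (conicX u) + + 2  ≡⟨ expand X ⟩
    P (+ 2 * X) 1ℤ                 ≈⟨ P-cong 2X≈a-b (≈-sym (inv-inverse u≢0)) ⟩
    P (a - b) (a * b)              ≡⟨ collapse a b ⟩
    a ^ 4 + b ^ 4                  ∎
    where
    a b X : ℤ
    a = ⟦ inv u ⟧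
    b = ⟦ u ⟧
    X = ⟦ conicX u ⟧
    P : ℤ → ℤ → ℤ
    P d e = (d * d) * (d * d) + + 4 * e * (d * d) + + 2 * (e * e)
    P-cong : ∀ {d d′ e e′} → d ≈ d′ → e ≈ e′ → P d e ≈ P d′ e′
    P-cong {d} {d′} d≈d′ e≈e′ =
      +-cong (+-cong (*-cong d²≈d′² d²≈d′²) (*-cong (*-cong (≈-refl {+ 4}) e≈e′) d²≈d′²))
             (*-cong (≈-refl {+ 2}) (*-cong e≈e′ e≈e′))
      where
      d²≈d′² : d * d ≈ d′ * d′
      d²≈d′² = *-cong d≈d′ d≈d′
    expand : ∀ X → + 16 * ((X * X) * (X * X) + X * X) + + 2
                   ≡ ((+ 2 * X) * (+ 2 * X)) * ((+ 2 * X) * (+ 2 * X))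
                     + + 4 * 1ℤ * ((+ 2 * X) * (+ 2 * X)) + + 2 * (1ℤ * 1ℤ)
    expand = solve-∀
    collapse : ∀ a b → ((a - b) * (a - b)) * ((a - b) * (a - b))
                       + + 4 * (a * b) * ((a - b) * (a - b)) + + 2 * ((a * b) * (a * b))
                       ≡ a * (a * (a * (a * 1ℤ))) + b * (b * (b * (b * 1ℤ)))
    collapse = solve-∀
    reassoc : ∀ a b h → + 2 * ((a - b) * h) ≡ (a - b) * (h * + 2)
    reassoc = solve-∀
    2X≈a-b : + 2 * X ≈ a - b
    2X≈a-b = begin
      + 2 * X              ≈⟨ *-cong (≈-refl {+ 2}) (⟦[]⟧ ((a - b) * ½)) ⟩
      + 2 * ((a - b) * ½)  ≡⟨ reassoc a b ½ ⟩
      (a - b) * (½ * + 2)  ≈⟨ *-cong (≈-refl {a - b}) ½*2≈1 ⟩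
      (a - b) * 1ℤ         ≡⟨ ℤ.*-identityʳ (a - b) ⟩
      a - b                ∎

  32T₀₀≈1 : + 32 * T false false ≈ 1ℤ
  32T₀₀≈1 = ≈0⇒≈ (*-cancelˡ-≈ (+ 32 * T₀₀ - 1ℤ) 0ℤ 2≉0 (begin
    + 2 * (+ 32 * T₀₀ - 1ℤ)                              ≡⟨ rearrange T₀₀ (+ m) ⟩
    (+ 16 * (+ 4 * T₀₀) + + m * + 2) - + 2 * (1ℤ + + m)
      ≈⟨ +-cong 64T₀₀+2m≈0 (-‿cong (y≈0⇒x*y≈0 (+ 2) n≈0)) ⟩
    0ℤ - 0ℤ
      ∎))
    where
    T₀₀ : ℤ
    T₀₀ = T false false
    rearrange : ∀ t m → + 2 * (+ 32 * t - 1ℤ) ≡ (+ 16 * (+ 4 * t) + m * + 2) - + 2 * (1ℤ + m)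
    rearrange = solve-∀
    units-sum : ∀ (h : Fin p → ℤ) → h zero ≡ 0ℤ → ∑[ i < m ] h (suc i) ≡ ∑[ u < p ] h u
    units-sum h h0≡0 = ≡.trans (≡.sym (ℤ.+-identityˡ _)) (cong (_+ ∑[ i < m ] h (suc i)) (≡.sym h0≡0))
    64T₀₀+2m≈0 : + 16 * (+ 4 * T₀₀) + + m * + 2 ≈ 0ℤ
    64T₀₀+2m≈0 = begin
      + 16 * (+ 4 * T₀₀) + + m * + 2
        ≈⟨ +-cong (*-cong (≈-refl {+ 16}) 4T₀₀≈∑conic) (≈-reflexive (≡.sym (∑-const m (+ 2)))) ⟩
      + 16 * ∑[ i < m ] f[x²] (conicX (suc i)) + ∑[ i < m ] (+ 2)
        ≈⟨ +-cong (*-distribˡ-sum (+ 16) (λ i → f[x²] (conicX (suc i)))) (≈-refl {∑[ i < m ] (+ 2)}) ⟩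
      ∑[ i < m ] (+ 16 * f[x²] (conicX (suc i))) + ∑[ i < m ] (+ 2)
        ≈⟨ ∑-distrib-+ (λ i → + 16 * f[x²] (conicX (suc i))) (λ _ → + 2) ⟨
      ∑[ i < m ] (+ 16 * f[x²] (conicX (suc i)) + + 2)
        ≈⟨ sum-cong-≋ (λ i → conic-identity {suc i} (λ ())) ⟩
      ∑[ i < m ] (⟦ inv (suc i) ⟧ ^ 4 + ⟦ suc i ⟧ ^ 4)
        ≡⟨ units-sum (λ u → ⟦ inv u ⟧ ^ 4 + ⟦ u ⟧ ^ 4) ≡.refl ⟩
      ∑[ u < p ] (⟦ inv u ⟧ ^ 4 + ⟦ u ⟧ ^ 4)
        ≈⟨ ∑-distrib-+ (λ u → ⟦ inv u ⟧ ^ 4) (λ u → ⟦ u ⟧ ^ 4) ⟩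
      ∑[ u < p ] (⟦ inv u ⟧ ^ 4) + ∑[ u < p ] (⟦ u ⟧ ^ 4)
        ≈⟨ +-cong (≈-sym (∑-inv (λ u → ⟦ u ⟧ ^ 4))) (≈-refl {∑[ u < p ] (⟦ u ⟧ ^ 4)}) ⟩
      ∑[ u < p ] (⟦ u ⟧ ^ 4) + ∑[ u < p ] (⟦ u ⟧ ^ 4)
        ≈⟨ +-cong ∑x⁴≈0 ∑x⁴≈0 ⟩
      0ℤ
        ∎

  32T₀₁+1≈0 : + 32 * T false true + 1ℤ ≈ 0ℤ
  32T₀₁+1≈0 = x+y≈0⇒[k*x≈1⇒k*y+1≈0] (+ 32) {T false false} {T false true}
    (≈-trans (T-sumʳ false) ∑χf≈0) 32T₀₀≈1

  32T₁₀+1≈0 : + 32 * T true false + 1ℤ ≈ 0ℤ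
  32T₁₀+1≈0 = x+y≈0⇒[k*x≈1⇒k*y+1≈0] (+ 32) {T false false} {T true false}
    (≈-trans (T-sumˡ false) ∑χ[a+1]f≈0) 32T₀₀≈1

  32T₁₁≈1 : + 32 * T true true ≈ 1ℤ
  32T₁₁≈1 = x+y≈0⇒[k*x+1≈0⇒k*y≈1] (+ 32) {T true false} {T true true}
    (≈-trans (T-sumʳ true) ∑𝟙A₁f≈0) 32T₁₀+1≈0

  32T≈1⇒32S≡1 : ∀ i j → + 32 * T i j ≈ 1ℤ → (32 ℕ.* S p i j) % p ≡ 1 % p
  32T≈1⇒32S≡1 i j 32T≈1 = ≈⇒%≡ {32 ℕ.* S p i j} {1}
    (≈-trans (≈-reflexive (ℤ.pos-* 32 (S p i j))) (≈-trans (*-cong (≈-refl {+ 32}) (S≈T i j)) 32T≈1))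

  32T+1≈0⇒32S+1≡0 : ∀ i j → + 32 * T i j + 1ℤ ≈ 0ℤ → (32 ℕ.* S p i j ℕ.+ 1) % p ≡ 0
  32T+1≈0⇒32S+1≡0 i j 32T+1≈0 = ≈⇒%≡ {32 ℕ.* S p i j ℕ.+ 1} {0}
    (≈-trans (≈-reflexive (≡.trans (ℤ.pos-+ (32 ℕ.* S p i j) 1) (cong (_+ 1ℤ) (ℤ.pos-* 32 (S p i j)))))
             (≈-trans (+-cong (*-cong (≈-refl {+ 32}) (S≈T i j)) (≈-refl {1ℤ})) 32T+1≈0))

mainTheorem2 : (p : ℕ) .{{_ : NonZero p}} → Prime p → 7 ℕ.≤ p →
      ((32 ℕ.* S p false false) % p ≡ 1 % p)
    × ((32 ℕ.* S p true true) % p ≡ 1 % p)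
    × ((32 ℕ.* S p false true ℕ.+ 1) % p ≡ 0)
    × ((32 ℕ.* S p true false ℕ.+ 1) % p ≡ 0)
mainTheorem2 (ℕ.suc m) isPrime 7≤p =
    32T≈1⇒32S≡1 false false 32T₀₀≈1
  , 32T≈1⇒32S≡1 true true 32T₁₁≈1
  , 32T+1≈0⇒32S+1≡0 false true 32T₀₁+1≈0
  , 32T+1≈0⇒32S+1≡0 true false 32T₁₀+1≈0
  where open ConsecutiveResidueSums isPrime 7≤p
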